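{- For every $N\ge 1$ there is a set $Q$ of at most $\left\lceil 2N/3+1\right\rceil$ queens on distinct squares of the $N\times N$ chessboard with the following two properties: (i) every square either contains a queen of $Q$ or lies in the same row, column or diagonal as some queen of $Q$; (ii) the graph $G(Q)$ is connected.
   Context: Squares are $(x,y)$ with $1\le x,y\le N$. A queen on $(x,y)$ covers every square in column $x$, in row $y$, and on the two diagonals through $(x,y)$; coverage is not blocked by other queens. A "line" means a row, a column, or a diagonal (in either direction). $G(Q)$ is the graph on the queens of $Q$ with an edge between two queens exactly when they lie on a common line and no other queen of $Q$ lies on that line strictly between them. -}

module Defs where

open import Data.Nat using (ℕ; _+_; _*_; _≤_; _<_; _/_)
open import Data.Product using (_×_; ∃; ∃-syntax; _,_; proj₁; proj₂)
open import Data.Sum using (_⊎_)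
open import Data.List using (List; length)
open import Data.List.Membership.Propositional using (_∈_)
open import Data.List.Relation.Unary.Unique.Propositional using (Unique)
open import Relation.Binary.PropositionalEquality using (_≡_; _≢_)
open import Relation.Binary.Construct.Closure.ReflexiveTransitive using (Star)
open import Relation.Nullary using (¬_)

Square : Set
Square = ℕ × ℕ

col row : Square → ℕ
col = proj₁
row = proj₂

OnBoard : ℕ → Square → Set
OnBoard N (x , y) = (1 ≤ x × x ≤ N) × (1 ≤ y × y ≤ N)

data LineKind : Set where
  rowL colL diagL antiL : LineKind

SameLine : LineKind → Square → Square → Set
SameLine rowL  (x₁ , y₁) (x₂ , y₂) = y₁ ≡ y₂
SameLine colL  (x₁ , y₁) (x₂ , y₂) = x₁ ≡ x₂
SameLine diagL (x₁ , y₁) (x₂ , y₂) = x₁ + y₂ ≡ x₂ + y₁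
SameLine antiL (x₁ , y₁) (x₂ , y₂) = x₁ + y₁ ≡ x₂ + y₂

pos : LineKind → Square → ℕ
pos rowL  (x , y) = x
pos colL  (x , y) = y
pos diagL (x , y) = x
pos antiL (x , y) = x

StrictlyBetween : LineKind → Square → Square → Square → Set
StrictlyBetween L p r q =
  SameLine L p r ×
  ((pos L p < pos L r × pos L r < pos L q) ⊎ (pos L q < pos L r × pos L r < pos L p))

Covers : Square → Square → Set
Covers q s = SameLine rowL q s ⊎ SameLine colL q s ⊎ SameLine diagL q s ⊎ SameLine antiL q s

Dominating : ℕ → List Square → Set
Dominating N Q = ∀ s → OnBoard N s → ∃[ q ] (q ∈ Q × Covers q s)

Adjacent : List Square → Square → Square → Set
Adjacent Q p q =
  p ∈ Q × q ∈ Q × p ≢ q ×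
  ∃[ L ] (SameLine L p q × (∀ r → r ∈ Q → ¬ StrictlyBetween L p r q))

Connected : List Square → Set
Connected Q = ∀ p q → p ∈ Q → q ∈ Q → Star (Adjacent Q) p q

-- ⌈2N/3 + 1⌉ = ⌈(2N+3)/3⌉ = ⌊(2N+5)/3⌋
bound : ℕ → ℕ
bound N = (2 * N + 5) / 3

-- Write N = a + c with c = 2m + 1 odd, and put queens at (x , x + c) for 1 ≤ x ≤ a and at
-- (x , x) for a ≤ x ≤ a + e, with a and e about N/3. Columns 1..a+e and rows a..a+e are then
-- attacked along files and ranks, the rows above a+e by the upper queens, and the remaining
-- bottom-right block along anti-diagonals: those with even sum meet the main diagonal, those with
-- odd sum meet the upper diagonal because c is odd. Consecutive queens on either diagonal are
-- adjacent, and column a, which holds exactly the two queens (a , a) and (a , a + c), joins them.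
module Submission where

open import Defs
open import Data.Nat using (ℕ; _≤_)
open import Data.Product using (_×_; ∃-syntax)
open import Data.List using (List; length)
open import Data.List.Relation.Unary.All using (All)
open import Data.List.Relation.Unary.Unique.Propositional using (Unique)

open import Function using (_∘_)
open import Data.Nat using (zero; suc; _+_; _*_; _∸_; _<_; _≤?_; z≤n; s≤s)
open import Data.Nat.Properties
open import Data.Nat.DivMod using (_divMod_; result; m*n/n≡m; /-monoˡ-≤)
open import Data.Nat.Tactic.RingSolver using (solve-∀)
open import Data.Fin using (zero; suc)
open import Data.Product using (_,_; proj₁; proj₂; swap)
open import Data.Sum using (_⊎_; inj₁; inj₂)
import Data.Sum as Sum
open import Data.List using ([]; _∷_; map; _++_; applyUpTo)
open import Data.List.Properties using (length-++; length-map; length-applyUpTo)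
open import Data.List.Membership.Propositional using (_∈_)
open import Data.List.Membership.Propositional.Properties
  using (∈-++⁺ˡ; ∈-++⁺ʳ; ∈-++⁻; ∈-map⁺; ∈-map⁻; ∈-applyUpTo⁺; ∈-applyUpTo⁻)
open import Data.List.Relation.Unary.Any using (here)
open import Data.List.Relation.Unary.All using ([]; _∷_)
import Data.List.Relation.Unary.All as All
open import Data.List.Relation.Unary.AllPairs using ([]; _∷_)
import Data.List.Relation.Unary.Unique.Propositional.Properties as Unique
open import Relation.Binary using (Rel)
open import Relation.Binary.Construct.Closure.ReflexiveTransitive using (Star; ε; _◅_; _◅◅_)
import Relation.Binary.Construct.Closure.ReflexiveTransitive as Star
open import Relation.Binary.PropositionalEquality
  using (_≡_; _≢_; refl; sym; trans; cong; cong₂; subst; ≢-sym; module ≡-Reasoning)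
open import Relation.Nullary using (¬_; yes; no; contradiction)

Between : ℕ → ℕ → ℕ → Set
Between u w v = (u < w × w < v) ⊎ (v < w × w < u)

¬Between-endpoint : ∀ {u w v} → w ≡ u ⊎ w ≡ v → ¬ Between u w v
¬Between-endpoint (inj₁ refl) (inj₁ (u<u , _)) = <-irrefl refl u<u
¬Between-endpoint (inj₁ refl) (inj₂ (_ , u<u)) = <-irrefl refl u<u
¬Between-endpoint (inj₂ refl) (inj₁ (_ , v<v)) = <-irrefl refl v<v
¬Between-endpoint (inj₂ refl) (inj₂ (v<v , _)) = <-irrefl refl v<v

¬Between-suc : ∀ {u w} → ¬ Between u w (suc u)
¬Between-suc (inj₁ (u<w , w<1+u)) = <⇒≱ u<w (≤-pred w<1+u)
¬Between-suc (inj₂ (1+u<w , w<u)) = <-asym (<-trans (n<1+n _) 1+u<w) w<u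

MutuallyAdjacent : List Square → Square → Square → Set
MutuallyAdjacent Q p q = Adjacent Q p q × Adjacent Q q p

diagonal-step : ∀ {Q x y} → (x , y) ∈ Q → (suc x , suc y) ∈ Q →
                MutuallyAdjacent Q (x , y) (suc x , suc y)
diagonal-step p∈Q q∈Q =
  (p∈Q , q∈Q , 1+n≢n ∘ sym ∘ cong col , diagL , +-suc _ _ ,
   λ _ _ → ¬Between-suc ∘ proj₂) ,
  (q∈Q , p∈Q , 1+n≢n ∘ cong col , diagL , sym (+-suc _ _) ,
   λ _ _ → ¬Between-suc ∘ Sum.swap ∘ proj₂)

column-step : ∀ {Q x y y′} → (x , y) ∈ Q → (x , y′) ∈ Q → y ≢ y′ →
              (∀ {r} → r ∈ Q → col r ≡ x → row r ≡ y ⊎ row r ≡ y′) →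
              MutuallyAdjacent Q (x , y) (x , y′)
column-step p∈Q q∈Q y≢y′ onlyTwo =
  (p∈Q , q∈Q , y≢y′ ∘ cong row , colL , refl ,
   λ _ r∈Q (x≡ , between) → ¬Between-endpoint (onlyTwo r∈Q (sym x≡)) between) ,
  (q∈Q , p∈Q , y≢y′ ∘ sym ∘ cong row , colL , refl ,
   λ _ r∈Q (x≡ , between) → ¬Between-endpoint (Sum.swap (onlyTwo r∈Q (sym x≡))) between)

star-along : ∀ {a ℓ} {A : Set a} {R : Rel A ℓ} (f : ℕ → A) {lo hi : ℕ} →
             (∀ {j} → lo ≤ j → suc j ≤ hi → R (f j) (f (suc j))) →
             ∀ {i j} → lo ≤ i → i ≤ j → j ≤ hi → Star R (f i) (f j)
star-along f step {j = zero} _ z≤n _ = ε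
star-along f step {i} {suc j} lo≤i i≤1+j 1+j≤hi with m≤n⇒m<n∨m≡n i≤1+j
... | inj₂ refl = ε
... | inj₁ (s≤s i≤j) =
  star-along f step lo≤i i≤j (≤-trans (n≤1+n j) 1+j≤hi) ◅◅ (step (≤-trans lo≤i i≤j) 1+j≤hi ◅ ε)

connected-via-root : ∀ {Q} root → (∀ {p} → p ∈ Q → Star (MutuallyAdjacent Q) p root) → Connected Q
connected-via-root root to-root _ _ p∈Q q∈Q =
  Star.map proj₁ (to-root p∈Q ◅◅ Star.reverse swap (to-root q∈Q))

range : ℕ → ℕ → List ℕ
range lo k = applyUpTo (lo +_) k

∈-range⁺ : ∀ {lo k x} → lo ≤ x → x < lo + k → x ∈ range lo k
∈-range⁺ {lo} lo≤x x<lo+k with d , refl ← m≤n⇒∃[o]m+o≡n lo≤x =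
  ∈-applyUpTo⁺ (lo +_) (+-cancelˡ-< lo d _ x<lo+k)

∈-range⁻ : ∀ {lo k x} → x ∈ range lo k → lo ≤ x × x < lo + k
∈-range⁻ {lo} x∈ with d , d<k , refl ← ∈-applyUpTo⁻ (lo +_) x∈ = m≤m+n lo d , +-monoʳ-< lo d<k

range-unique : ∀ lo k → Unique (range lo k)
range-unique lo k = Unique.applyUpTo⁺₁ (lo +_) k (λ i<j _ → <⇒≢ i<j ∘ +-cancelˡ-≡ lo _ _)

parity : ∀ n → ∃[ h ] (n ≡ h + h ⊎ n ≡ suc (h + h))
parity zero = 0 , inj₁ refl
parity (suc n) with parity n
... | h , inj₁ refl = h , inj₂ refl
... | h , inj₂ refl = suc h , inj₁ (cong suc (sym (+-suc h h)))

double-≤-cancel : ∀ {h k} → h + h ≤ suc (k + k) → h ≤ k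
double-≤-cancel {h} {k} hh≤ = ≮⇒≥ λ k<h →
  1+n≰n (≤-trans (subst (_≤ h + h) (cong suc (+-suc k k)) (+-mono-≤ k<h k<h)) hh≤)

size≤bound : ∀ {L} N d → 3 * L + d ≡ 2 * N + 5 → L ≤ bound N
size≤bound {L} N d eq = subst (_≤ bound N) (m*n/n≡m L 3)
  (/-monoˡ-≤ 3 (subst (_≤ 2 * N + 5) (*-comm 3 L) (subst (3 * L ≤_) eq (m≤m+n (3 * L) d))))

ConnectedDominatingSet : ℕ → ℕ → Set
ConnectedDominatingSet N k =
  ∃[ Q ] (Unique Q × All (OnBoard N) Q × length Q ≤ k × Dominating N Q × Connected Q)

module TwoDiagonals (a m e : ℕ) (1≤a : 1 ≤ a) (c≤a+e : suc (m + m) ≤ a + e)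
                    (e≤c : e ≤ suc (m + m)) (a≤3+e : a ≤ 3 + e) (m≤e : m ≤ e) where

  c t N : ℕ
  c = suc (m + m)
  t = a + e
  N = a + c

  upper lower : ℕ → Square
  upper x = (x , x + c)
  lower x = (x , x)

  Uppers Lowers Q : List Square
  Uppers = map upper (range 1 a)
  Lowers = map lower (range a (suc e))
  Q = Uppers ++ Lowers

  upper∈Q : ∀ {x} → 1 ≤ x → x ≤ a → upper x ∈ Q
  upper∈Q 1≤x x≤a = ∈-++⁺ˡ (∈-map⁺ upper (∈-range⁺ 1≤x (s≤s x≤a)))

  lower∈Q : ∀ {x} → a ≤ x → x ≤ t → lower x ∈ Q
  lower∈Q {x} a≤x x≤t =
    ∈-++⁺ʳ Uppers (∈-map⁺ lower (∈-range⁺ a≤x (subst (x <_) (sym (+-suc a e)) (s≤s x≤t))))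

  ∈Q⁻ : ∀ {r} → r ∈ Q →
        (∃[ x ] (1 ≤ x × x ≤ a × r ≡ upper x)) ⊎ (∃[ x ] (a ≤ x × x ≤ t × r ≡ lower x))
  ∈Q⁻ r∈Q with ∈-++⁻ Uppers r∈Q
  ... | inj₁ r∈U with x , x∈ , refl ← ∈-map⁻ upper r∈U =
    let 1≤x , x<1+a = ∈-range⁻ x∈ in inj₁ (x , 1≤x , ≤-pred x<1+a , refl)
  ... | inj₂ r∈L with x , x∈ , refl ← ∈-map⁻ lower r∈L =
    let a≤x , x<a+1+e = ∈-range⁻ x∈ in
    inj₂ (x , a≤x , ≤-pred (subst (x <_) (+-suc a e) x<a+1+e) , refl)

  Q-unique : Unique Q
  Q-unique = Unique.++⁺ (Unique.map⁺ (cong col) (range-unique 1 a))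
                        (Unique.map⁺ (cong col) (range-unique a (suc e))) disjoint
    where
    disjoint : ∀ {r} → ¬ (r ∈ Uppers × r ∈ Lowers)
    disjoint (r∈U , r∈L) with x , _ , refl ← ∈-map⁻ upper r∈U
                         with y , _ , eq ← ∈-map⁻ lower r∈L =
      m+1+n≢m x (trans (cong row eq) (sym (cong col eq)))

  Q-onBoard : All (OnBoard N) Q
  Q-onBoard = All.tabulate onBoard
    where
    onBoard : ∀ {r} → r ∈ Q → OnBoard N r
    onBoard r∈Q with ∈Q⁻ r∈Q
    ... | inj₁ (x , 1≤x , x≤a , refl) =
      (1≤x , ≤-trans x≤a (m≤m+n a c)) , (≤-trans 1≤x (m≤m+n x c) , +-monoˡ-≤ c x≤a)
    ... | inj₂ (x , a≤x , x≤t , refl) =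
      let onDiagonal = ≤-trans 1≤a a≤x , ≤-trans x≤t (+-monoʳ-≤ a e≤c) in onDiagonal , onDiagonal

  Q-length : length Q ≡ a + suc e
  Q-length = begin
    length Q                                      ≡⟨ length-++ Uppers ⟩
    length Uppers + length Lowers
      ≡⟨ cong₂ _+_ (length-map upper (range 1 a)) (length-map lower (range a (suc e))) ⟩
    length (range 1 a) + length (range a (suc e))
      ≡⟨ cong₂ _+_ (length-applyUpTo (1 +_) a) (length-applyUpTo (a +_) (suc e)) ⟩
    a + suc e                                     ∎
    where open ≡-Reasoning

  Q-connected : Connected Q
  Q-connected = connected-via-root (upper a) to-root
    where
    upper-step : ∀ {x} → 1 ≤ x → suc x ≤ a → MutuallyAdjacent Q (upper x) (upper (suc x))
    upper-step 1≤x 1+x≤a =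
      diagonal-step (upper∈Q 1≤x (≤-trans (n≤1+n _) 1+x≤a)) (upper∈Q (s≤s z≤n) 1+x≤a)

    lower-step : ∀ {x} → a ≤ x → suc x ≤ t → MutuallyAdjacent Q (lower x) (lower (suc x))
    lower-step a≤x 1+x≤t =
      diagonal-step (lower∈Q a≤x (≤-trans (n≤1+n _) 1+x≤t)) (lower∈Q (≤-trans a≤x (n≤1+n _)) 1+x≤t)

    column-a : MutuallyAdjacent Q (lower a) (upper a)
    column-a = column-step (lower∈Q ≤-refl (m≤m+n a e)) (upper∈Q 1≤a ≤-refl) (≢-sym (m+1+n≢m a)) onlyTwo
      where
      onlyTwo : ∀ {r} → r ∈ Q → col r ≡ a → row r ≡ a ⊎ row r ≡ a + c
      onlyTwo r∈Q col≡a with ∈Q⁻ r∈Q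
      ... | inj₁ (x , _ , _ , refl) = inj₂ (cong (_+ c) col≡a)
      ... | inj₂ (x , _ , _ , refl) = inj₁ col≡a

    to-root : ∀ {p} → p ∈ Q → Star (MutuallyAdjacent Q) p (upper a)
    to-root p∈Q with ∈Q⁻ p∈Q
    ... | inj₁ (x , 1≤x , x≤a , refl) = star-along upper upper-step 1≤x x≤a ≤-refl
    ... | inj₂ (x , a≤x , x≤t , refl) =
      Star.reverse swap (star-along lower lower-step ≤-refl a≤x x≤t) ◅◅ column-a ◅ ε

  half-≤-a+m : ∀ {h s} → h + h ≤ s → s < N + a → h ≤ a + m
  half-≤-a+m {h} {s} hh≤s s<N+a =
    double-≤-cancel (≤-trans hh≤s (≤-trans (n≤1+n s) (subst (suc s ≤_) (N+a≡1+2[a+m] a m) s<N+a)))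
    where
    N+a≡1+2[a+m] : ∀ a m → a + suc (m + m) + a ≡ suc ((a + m) + (a + m))
    N+a≡1+2[a+m] = solve-∀

  antidiagonal-covered : ∀ {s} → 2 + t ≤ s → s < N + a → ∃[ q ] (q ∈ Q × col q + row q ≡ s)
  antidiagonal-covered {s} 2+t≤s s<N+a with parity s
  ... | h , inj₁ refl =
    lower h , lower∈Q a≤h (≤-trans (half-≤-a+m ≤-refl s<N+a) (+-monoʳ-≤ a m≤e)) , refl
    where
    a≤h : a ≤ h
    a≤h = double-≤-cancel (begin
      a + a       ≤⟨ +-monoʳ-≤ a a≤3+e ⟩
      a + (3 + e) ≡⟨ a+[3+e]≡3+t a e ⟩
      suc (2 + t) ≤⟨ s≤s 2+t≤s ⟩
      suc (h + h) ∎)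
      where
      open ≤-Reasoning
      a+[3+e]≡3+t : ∀ a e → a + (3 + e) ≡ suc (2 + (a + e))
      a+[3+e]≡3+t = solve-∀
  ... | h , inj₂ refl = upper u , upper∈Q (m<n⇒0<n∸m m<h) u≤a , covers
    where
    u≤a : h ∸ m ≤ a
    u≤a = m≤n+o⇒m∸n≤o h m (subst (h ≤_) (+-comm a m) (half-≤-a+m (n≤1+n _) s<N+a))
    m<h : m < h
    m<h = double-≤-cancel (begin
      suc m + suc m ≡⟨ cong suc (+-suc m m) ⟩
      suc c         ≤⟨ n≤1+n _ ⟩
      2 + c         ≤⟨ +-monoʳ-≤ 2 c≤a+e ⟩
      2 + t         ≤⟨ 2+t≤s ⟩
      suc (h + h)   ∎)
      where open ≤-Reasoning
    u : ℕ
    u = h ∸ m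
    covers : u + (u + c) ≡ suc (h + h)
    covers = begin
      u + (u + c)             ≡⟨ u+[u+c]≡1+2[u+m] u m ⟩
      suc ((u + m) + (u + m)) ≡⟨ cong (λ z → suc (z + z)) (m∸n+n≡m (<⇒≤ m<h)) ⟩
      suc (h + h)             ∎
      where
      open ≡-Reasoning
      u+[u+c]≡1+2[u+m] : ∀ u m → u + (u + suc (m + m)) ≡ suc ((u + m) + (u + m))
      u+[u+c]≡1+2[u+m] = solve-∀

  Q-dominating : Dominating N Q
  Q-dominating (x , y) ((1≤x , x≤N) , (1≤y , y≤N)) with x ≤? a | x ≤? t | a ≤? y | y ≤? t
  ... | yes x≤a | _ | _ | _ = upper x , upper∈Q 1≤x x≤a , inj₂ (inj₁ refl)
  ... | no x≰a | yes x≤t | _ | _ = lower x , lower∈Q (<⇒≤ (≰⇒> x≰a)) x≤t , inj₂ (inj₁ refl)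
  ... | no _ | no _ | yes a≤y | yes y≤t = lower y , lower∈Q a≤y y≤t , inj₁ refl
  ... | no _ | no _ | yes _ | no y≰t =
    upper (y ∸ c) , upper∈Q (m<n⇒0<n∸m c<y) (m≤n+o⇒m∸n≤o y c (subst (y ≤_) (+-comm a c) y≤N)) ,
    inj₁ (m∸n+n≡m (<⇒≤ c<y))
    where
    c<y : c < y
    c<y = <-≤-trans (s≤s c≤a+e) (≰⇒> y≰t)
  ... | no _ | no x≰t | no a≰y | _ =
    let q , q∈Q , q-sum = antidiagonal-covered 2+t≤x+y x+y<N+a in q , q∈Q , inj₂ (inj₂ (inj₂ q-sum))
    where
    2+t≤x+y : 2 + t ≤ x + y
    2+t≤x+y = subst (_≤ x + y) (+-comm (suc t) 1) (+-mono-≤ (≰⇒> x≰t) 1≤y)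
    x+y<N+a : x + y < N + a
    x+y<N+a = subst (_≤ N + a) (+-suc x y) (+-mono-≤ x≤N (≰⇒> a≰y))

  connectedDominatingSet : ConnectedDominatingSet N (a + suc e)
  connectedDominatingSet = Q , Q-unique , Q-onBoard , ≤-reflexive Q-length , Q-dominating , Q-connected

twoDiagonals : ∀ {N k} a m e → 1 ≤ a → suc (m + m) ≤ a + e → e ≤ suc (m + m) → a ≤ 3 + e → m ≤ e →
               N ≡ a + suc (m + m) → a + suc e ≤ k → ConnectedDominatingSet N k
twoDiagonals a m e 1≤a c≤a+e e≤c a≤3+e m≤e refl size≤k
  with Q , unique , onBoard , length≤ , dominating , connected ←
       TwoDiagonals.connectedDominatingSet a m e 1≤a c≤a+e e≤c a≤3+e m≤e =
  Q , unique , onBoard , ≤-trans length≤ size≤k , dominating , connected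

singleQueen : ConnectedDominatingSet 1 (bound 1)
singleQueen =
  (1 , 1) ∷ [] , [] ∷ [] , onBoard ∷ [] , s≤s z≤n ,
  (λ { _ (_ , (1≤y , y≤1)) → (1 , 1) , here refl , inj₁ (≤-antisym 1≤y y≤1) }) ,
  λ { _ _ (here refl) (here refl) → ε }
  where
  onBoard : OnBoard 1 (1 , 1)
  onBoard = (≤-refl , ≤-refl) , (≤-refl , ≤-refl)

board-3k+3 : ∀ k → 3 + k * 3 ≡ (2 + k) + suc (k + k)
board-3k+3 = solve-∀

size-3k+3 : ∀ k → 3 * ((2 + k) + suc k) + 2 ≡ 2 * (3 + k * 3) + 5
size-3k+3 = solve-∀

board-3k+4 : ∀ k → 4 + k * 3 ≡ (3 + k) + suc (k + k)
board-3k+4 = solve-∀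

size-3k+4 : ∀ k → 3 * ((3 + k) + suc k) + 1 ≡ 2 * (4 + k * 3) + 5
size-3k+4 = solve-∀

board-3k+2 : ∀ k → 2 + k * 3 ≡ suc k + suc (k + k)
board-3k+2 = solve-∀

size-3k+2 : ∀ k → 3 * (suc k + suc (suc k)) + 0 ≡ 2 * (2 + k * 3) + 5
size-3k+2 = solve-∀

mainTheorem2 : (N : ℕ) → 1 ≤ N →
    ∃[ Q ] (Unique Q × All (OnBoard N) Q × length Q ≤ bound N ×
            Dominating N Q × Connected Q)
mainTheorem2 N 1≤N with N divMod 3
... | result zero zero refl = contradiction 1≤N λ ()
... | result (suc k) zero refl =
  twoDiagonals (2 + k) k k (s≤s z≤n) (n≤1+n _) (≤-trans (m≤m+n k k) (n≤1+n _)) (n≤1+n _) ≤-refl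
    (board-3k+3 k) (size≤bound (3 + k * 3) 2 (size-3k+3 k))
... | result zero (suc zero) refl = singleQueen
... | result (suc k) (suc zero) refl =
  twoDiagonals (3 + k) k k (s≤s z≤n) (m≤n+m _ 2) (≤-trans (m≤m+n k k) (n≤1+n _)) ≤-refl ≤-refl
    (board-3k+4 k) (size≤bound (4 + k * 3) 1 (size-3k+4 k))
... | result k (suc (suc zero)) refl =
  twoDiagonals (suc k) k (suc k) (s≤s z≤n) (≤-trans (n≤1+n _) (≤-reflexive (cong suc (sym (+-suc k k)))))
    (s≤s (m≤m+n k k)) (m≤n+m _ 3) (n≤1+n k)
    (board-3k+2 k) (size≤bound (2 + k * 3) 0 (size-3k+2 k))
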